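{- Every graph with boolean-width $k$ has twin-width at most $2^{k+1}-1$.
   Context: Graphs are finite, simple, undirected. The boolean-width of a partition $(A,B)$ of $V(G)$ is the base-2 logarithm of the number of distinct sets $N(S)\cap B$ for $S\subseteq A$. A decomposition tree of $G$ is a tree in which every internal node has exactly two children, whose leaves are in bijection with $V(G)$; each edge $e$ of the tree yields the partition $(A_e,B_e)$ of $V(G)$ given by the leaves of the two components of the tree minus $e$. The boolean-width of a decomposition tree is the maximum boolean-width of $(A_e,B_e)$ over its edges, and the boolean-width of $G$ is the minimum over all decomposition trees. Twin-width: a trigraph is $(V,E,R)$ with disjoint black edge set $E$ and red edge set $R$; a graph $(V,E)$ is the trigraph $(V,E,\emptyset)$. Contracting distinct vertices $u,v$ replaces them by $w$, keeps the rest, and for each other vertex $x$: $wx$ black iff $ux,vx$ both black; $wx$ absent iff neither $ux$ nor $vx$ is black or red; $wx$ red otherwise. The twin-width of an $n$-vertex graph $G$ is the least $d$ such that some sequence $G=G_n,\ldots,G_1$ of single contractions ending in one vertex has all $G_i$ of maximum red degree at most $d$. -}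

module Defs where

open import Data.Bool using (Bool; true; false; _∧_; _∨_; if_then_else_)
open import Data.Bool.Properties using () renaming (_≟_ to _≟ᵇ_)
open import Data.Nat using (ℕ; zero; suc; _⊔_; _≤_; _+_)
open import Data.Fin using (Fin; punchIn; _≟_)
open import Data.Fin.Subset using (Subset; _∩_; ∁)
open import Data.List using (List; []; _∷_; _++_; map; foldr; length; allFin; deduplicate)
open import Data.Nat.ListAction using (sum)
open import Data.List.Relation.Binary.Permutation.Propositional using (_↭_)
open import Data.Vec using (Vec; tabulate; lookup) renaming ([] to []ᵥ; _∷_ to _∷ᵥ_)
open import Data.Vec.Properties using (≡-dec)
open import Data.Product using (Σ; ∃; _×_; _,_)
open import Relation.Nullary using (¬_; yes; no; does)
open import Relation.Binary.PropositionalEquality using (_≡_)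

record Graph (n : ℕ) : Set where
  field
    adj   : Fin n → Fin n → Bool
    sym   : ∀ u v → adj u v ≡ adj v u
    irrefl : ∀ u → adj u u ≡ false
open Graph public

allSubsets : (n : ℕ) → List (Subset n)
allSubsets zero = []ᵥ ∷ []
allSubsets (suc n) = map (true ∷ᵥ_) (allSubsets n) ++ map (false ∷ᵥ_) (allSubsets n)

anyFin : ∀ {n} → (Fin n → Bool) → Bool
anyFin {n} p = foldr _∨_ false (map p (allFin n))

nbhd : ∀ {n} → Graph n → Subset n → Subset n
nbhd G S = tabulate λ v → anyFin λ u → lookup S u ∧ adj G u v

distinctNbhds : ∀ {n} → Graph n → Subset n → List (Subset n)
distinctNbhds {n} G A =
  deduplicate (≡-dec _≟ᵇ_)
    (map (λ S → nbhd G (S ∩ A) ∩ ∁ A) (allSubsets n))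

-- 2^(boolean-width of the cut (A, complement A)): number of distinct N(S) ∩ B
cutCount : ∀ {n} → Graph n → Subset n → ℕ
cutCount G A = length (distinctNbhds G A)

data BTree (n : ℕ) : Set where
  leaf : Fin n → BTree n
  node : BTree n → BTree n → BTree n

leaves : ∀ {n} → BTree n → List (Fin n)
leaves (leaf v)   = v ∷ []
leaves (node l r) = leaves l ++ leaves r

IsDecompTree : ∀ {n} → BTree n → Set
IsDecompTree {n} T = leaves T ↭ allFin n

leafSet : ∀ {n} → BTree n → Subset n
leafSet T = tabulate λ v → foldr (λ w b → does (v ≟ w) ∨ b) false (leaves T)

-- all proper (non-root) subtrees; each corresponds to exactly one tree edge
-- (the edge to its parent), and the edge's partition is
-- (leaves of the subtree, remaining leaves)
properSubtrees : ∀ {n} → BTree n → List (BTree n)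
properSubtrees (leaf v)   = []
properSubtrees (node l r) = l ∷ r ∷ properSubtrees l ++ properSubtrees r

-- 2^(boolean-width of the decomposition tree): maximum of cutCount over
-- tree edges; the maximum of an empty set of widths is boolean-width 0,
-- i.e. count 1 = 2^0.
treeCount : ∀ {n} → Graph n → BTree n → ℕ
treeCount G T = foldr _⊔_ 1 (map (λ S → cutCount G (leafSet S)) (properSubtrees T))

-- G has boolean-width log₂ N
HasBoolWidthExp : ∀ {n} → Graph n → ℕ → Set
HasBoolWidthExp G N =
  Σ (BTree _) (λ T → IsDecompTree T × treeCount G T ≡ N)
  × (∀ (T : BTree _) → IsDecompTree T → N ≤ treeCount G T)

data Colour : Set where
  none black red : Colour

Trigraph : ℕ → Set
Trigraph m = Fin m → Fin m → Colour

toTrigraph : ∀ {n} → Graph n → Trigraph n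
toTrigraph G u v = if adj G u v then black else none

mergeColour : Colour → Colour → Colour
mergeColour black black = black
mergeColour none  none  = none
mergeColour _     _     = red

-- contract distinct u, v of a trigraph on Fin (suc m); the result lives on
-- Fin m, identified with Fin (suc m) minus v via punchIn v, and the new
-- vertex w sits at the position of u.
contract : ∀ {m} → Trigraph (suc m) → (u v : Fin (suc m)) → Trigraph m
contract c u v x y with punchIn v x ≟ u | punchIn v y ≟ u
... | yes _ | yes _ = none
... | yes _ | no  _ = mergeColour (c u (punchIn v y)) (c v (punchIn v y))
... | no  _ | yes _ = mergeColour (c (punchIn v x) u) (c (punchIn v x) v)
... | no  _ | no  _ = c (punchIn v x) (punchIn v y)

isRed : Colour → Bool
isRed red = true
isRed _   = false

redDegree : ∀ {m} → Trigraph m → Fin m → ℕ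
redDegree {m} c x = sum (map (λ y → if isRed (c x y) then 1 else 0) (allFin m))

MaxRedDegAtMost : ∀ {m} → ℕ → Trigraph m → Set
MaxRedDegAtMost d c = ∀ x → redDegree c x ≤ d

data ContrSeq (d : ℕ) : {m : ℕ} → Trigraph (suc m) → Set where
  done : (c : Trigraph 1) → MaxRedDegAtMost d c → ContrSeq d c
  step : ∀ {m} (c : Trigraph (suc (suc m))) → MaxRedDegAtMost d c →
         (u v : Fin (suc (suc m))) → ¬ (u ≡ v) →
         ContrSeq d (contract c u v) → ContrSeq d c

TwinWidthAtMost : ∀ {n} → Graph (suc n) → ℕ → Set
TwinWidthAtMost G d = ContrSeq d (toTrigraph G)

-- Contract along a decomposition tree T whose cuts all have at most N distinct neighbourhood traces,
-- finishing its nodes bottom-up. Every part (vertex of the current trigraph) lies inside one finished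
-- subtree, its block, and its members have the same neighbours outside that block. Finishing a node
-- S = l ∪ r merges the parts inside S with equal neighbourhoods outside S; before that, parts inside l
-- are already determined by their neighbourhoods outside l, so at most N of them meet l, and likewise r.
-- A red edge from a part x with block S must reach another part meeting S (otherwise x and y would be
-- homogeneous), so red degrees never exceed 2N − 1. At the root nothing lies outside the block, and the
-- remaining parts merge freely.

module Submission where

open import Defs hiding (sym)
open import Data.Bool using (Bool; true; false; T; _∧_; _∨_; not; if_then_else_)
open import Data.Bool.Properties using (T-≡; T-∧; ∧-identityʳ) renaming (_≟_ to _≟ᵇ_)
open import Data.Empty using (⊥-elim)
open import Data.Fin using (Fin; zero; suc; punchIn; punchOut; _↑ˡ_; _↑ʳ_; splitAt; _≟_)
open import Data.Fin.Properties
  using ( any?; suc-injective; punchIn-injective; punchInᵢ≢i; punchIn-punchOut; punchOut-injective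
        ; splitAt-↑ˡ; splitAt-↑ʳ; ↑ˡ-injective; ↑ʳ-injective)
open import Data.Fin.Subset using (Subset; _∩_; ∁; ⁅_⁆)
open import Data.Fin.Subset.Properties using (x∈⁅x⁆; x∈⁅y⁆⇒x≡y; x∈p∩q⁺; x∈p∩q⁻)
open import Data.List as List using (List; []; _∷_; _++_; map; foldr; allFin; tabulate)
open import Data.List.Properties using (map-tabulate; foldr-forcesᵇ)
open import Data.List.Membership.Propositional using (_∈_; _∉_; lose)
open import Data.List.Membership.Propositional.Properties
  using (∈-allFin; ∈-++⁻; ∈-++⁺ˡ; ∈-++⁺ʳ; ∈-map⁺; ∈-deduplicate⁺)
open import Data.List.Relation.Unary.All as All using (All; []; _∷_)
open import Data.List.Relation.Unary.All.Properties using (++⁻ˡ; ++⁻ʳ; ++⁻; map⁻)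
open import Data.List.Relation.Unary.Any using (here; there; index; satisfied)
open import Data.List.Relation.Unary.Any.Properties using (any⁺; any⁻; lookup-index)
open import Data.List.Relation.Unary.AllPairs using ([]; _∷_)
open import Data.List.Relation.Unary.Unique.Propositional using (Unique)
open import Data.List.Relation.Unary.Unique.Propositional.Properties using (allFin⁺)
open import Data.List.Relation.Binary.Disjoint.Propositional using (Disjoint)
open import Data.List.Relation.Binary.Subset.Propositional using (_⊆_)
open import Data.List.Relation.Binary.Permutation.Propositional using (↭-sym; ↭⇒↭ₛ)
open import Data.List.Relation.Binary.Permutation.Propositional.Properties using (∈-resp-↭)
import Data.List.Relation.Binary.Permutation.Setoid.Properties as Permutation
open import Data.Nat using (ℕ; zero; suc; _≤_; _<_; _+_; _*_; _∸_; z≤n; s≤s)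
open import Data.Nat.Properties
  using (≤-trans; ≤-reflexive; +-mono-≤; ∸-monoˡ-≤; +-identityʳ; m⊔n≤o⇒m≤o; m⊔n≤o⇒n≤o)
open import Data.Nat.ListAction using (sum)
open import Data.Product using (_×_; _,_; proj₁; proj₂; ∃₂; ∃-syntax)
open import Data.Sum using (_⊎_; inj₁; inj₂)
open import Data.Unit using (⊤; tt)
open import Data.Vec using (lookup) renaming ([] to []ᵥ; _∷_ to _∷ᵥ_)
open import Data.Vec.Properties
  using (≡-dec; lookup∘tabulate; lookup-zipWith; lookup-map; []=⇒lookup; lookup⇒[]=)
open import Function using (_∘_; Equivalence)
open import Relation.Nullary using (¬_; yes; no; Dec; does; contradiction)
open import Relation.Nullary.Decidable using (dec-true; dec-false; _×-dec_; ¬?; decidable-stable)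
open import Relation.Binary.PropositionalEquality
  using (_≡_; _≢_; refl; sym; trans; cong; cong₂; subst; setoid; module ≡-Reasoning)

-- Shaped so that redDegree c x is definitionally count (isRed ∘ c x).
count : ∀ {m} → (Fin m → Bool) → ℕ
count {m} P = sum (map (λ y → if P y then 1 else 0) (allFin m))

count-suc : ∀ {m} (P : Fin (suc m) → Bool) → count P ≡ (if P zero then 1 else 0) + count (P ∘ suc)
count-suc {m} P =
  cong (λ ys → ind zero + sum ys) (trans (map-tabulate suc ind) (sym (map-tabulate (λ y → y) (ind ∘ suc))))
  where
  ind : Fin (suc m) → ℕ
  ind y = if P y then 1 else 0

Injection : ∀ {m K} {P : Fin m → Bool} → (∀ y → T (P y) → Fin K) → Set
Injection k = ∀ {y y′} p p′ → k y p ≡ k y′ p′ → y ≡ y′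

mutual
  count≤ : ∀ {m K} (P : Fin m → Bool) (k : ∀ y → T (P y) → Fin K) → Injection k → count P ≤ K
  count≤ {zero}  P k inj = z≤n
  count≤ {suc m} P k inj rewrite count-suc P with P zero in eq
  ... | false = count≤ (P ∘ suc) (k ∘ suc) (λ p p′ → suc-injective ∘ inj p p′)
  ... | true  = count<-avoiding (P ∘ suc) (k zero p₀) (k ∘ suc) avoid (λ p p′ → suc-injective ∘ inj p p′)
    where
    p₀ : T (P zero)
    p₀ = subst T (sym eq) tt
    avoid : ∀ {y} p → k (suc y) p ≢ k zero p₀
    avoid p e with () ← inj p p₀ e

  count<-avoiding : ∀ {m K} (P : Fin m → Bool) (k₀ : Fin K) (k : ∀ y → T (P y) → Fin K) →
                    (∀ {y} p → k y p ≢ k₀) → Injection k → count P < K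
  count<-avoiding {K = suc K} P k₀ k avoid inj =
    s≤s (count≤ P (λ y p → punchOut (avoid p ∘ sym))
                  λ p p′ → inj p p′ ∘ punchOut-injective (avoid p ∘ sym) (avoid p′ ∘ sym))

count-never : ∀ {m} (P : Fin m → Bool) → (∀ y → ¬ T (P y)) → count P ≤ 0
count-never P never = count≤ P (λ y p → ⊥-elim (never y p)) (λ {y} p → ⊥-elim (never y p))

<-+-bound : ∀ {x y z n} → x < y + z → y ≤ n → z ≤ n → x ≤ 2 * n ∸ 1
<-+-bound {y = y} {z} {n} x<y+z y-small z-small =
  ∸-monoˡ-≤ 1 (≤-trans x<y+z (subst (y + z ≤_) (cong (n +_) (sym (+-identityʳ n))) (+-mono-≤ y-small z-small)))

T-injective : ∀ {x y} → (T x → T y) → (T y → T x) → x ≡ y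
T-injective {false} {false} _ _ = refl
T-injective {false} {true}  _ g = ⊥-elim (g tt)
T-injective {true}  {false} f _ = ⊥-elim (f tt)
T-injective {true}  {true}  _ _ = refl

anyFin-single : ∀ {n} (p : Fin n → Bool) {a} → (∀ {u} → T (p u) → u ≡ a) → anyFin p ≡ p a
anyFin-single p {a} only = T-injective
  (λ t → let u , pu = satisfied (any⁻ p (allFin _) t) in subst (T ∘ p) (only pu) pu)
  (λ pa → any⁺ p (lose (∈-allFin a) pa))

Unique-++⁻ : ∀ {A : Set} (xs : List A) {ys} → Unique (xs ++ ys) → Unique xs × Unique ys × Disjoint xs ys
Unique-++⁻ []       u         = [] , u , λ { (() , _) }
Unique-++⁻ (x ∷ xs) (x∉ ∷ u) with uxs , uys , disjoint ← Unique-++⁻ xs u =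
  ++⁻ˡ xs x∉ ∷ uxs , uys , λ
    { (here refl , x∈ys) → All.lookup (++⁻ʳ xs x∉) x∈ys refl
    ; (there v∈xs , v∈ys) → disjoint (v∈xs , v∈ys)
    }

∈-allSubsets : ∀ {n} (S : Subset n) → S ∈ allSubsets n
∈-allSubsets []ᵥ = here refl
∈-allSubsets {suc n} (true  ∷ᵥ S) = ∈-++⁺ˡ (∈-map⁺ (true ∷ᵥ_) (∈-allSubsets S))
∈-allSubsets {suc n} (false ∷ᵥ S) =
  ∈-++⁺ʳ (map (true ∷ᵥ_) (allSubsets n)) (∈-map⁺ (false ∷ᵥ_) (∈-allSubsets S))

colour : Bool → Colour
colour t = if t then black else none

mergeColour-colour : ∀ {c₁ c₂ t} → c₁ ≡ colour t → c₂ ≡ colour t → mergeColour c₁ c₂ ≡ colour t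
mergeColour-colour {t = false} refl refl = refl
mergeColour-colour {t = true}  refl refl = refl

colour-not-red : ∀ t → ¬ T (isRed (colour t))
colour-not-red false ()
colour-not-red true  ()

↑ˡ≢↑ʳ : ∀ {m n} {i : Fin m} {j : Fin n} → i ↑ˡ n ≢ m ↑ʳ j
↑ˡ≢↑ʳ {m} {n} {i} {j} e with () ← trans (sym (splitAt-↑ˡ m i n)) (trans (cong (splitAt m) e) (splitAt-↑ʳ m n j))

module _ {m : ℕ} {u v : Fin (suc m)} (u≢v : u ≢ v) where

  -- The renaming of parts performed by contract c u v: v joins u, and the other parts shift past v.
  squash : Fin (suc m) → Fin m
  squash z with z ≟ v
  ... | yes _   = punchOut (u≢v ∘ sym)
  ... | no  z≢v = punchOut (z≢v ∘ sym)

  punchIn-squash-≡ : ∀ {z} → z ≡ v → punchIn v (squash z) ≡ u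
  punchIn-squash-≡ {z} z≡v with z ≟ v
  ... | yes _   = punchIn-punchOut _
  ... | no  z≢v = contradiction z≡v z≢v

  punchIn-squash-≢ : ∀ {z} → z ≢ v → punchIn v (squash z) ≡ z
  punchIn-squash-≢ {z} z≢v with z ≟ v
  ... | yes z≡v = contradiction z≡v z≢v
  ... | no  _   = punchIn-punchOut _

  squash-u : ∀ {x} → punchIn v x ≡ u → squash u ≡ x
  squash-u p = punchIn-injective v _ _ (trans (punchIn-squash-≢ u≢v) (sym p))

  squash-v : ∀ {x} → punchIn v x ≡ u → squash v ≡ x
  squash-v p = punchIn-injective v _ _ (trans (punchIn-squash-≡ refl) (sym p))

  squash-punchIn : ∀ x → squash (punchIn v x) ≡ x
  squash-punchIn x = punchIn-injective v _ _ (punchIn-squash-≢ (punchInᵢ≢i v x))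

  squash-cases : ∀ {z z′} → squash z ≡ squash z′ → z ≡ z′ ⊎ (z ≡ u × z′ ≡ v) ⊎ (z ≡ v × z′ ≡ u)
  squash-cases {z} {z′} e = cases (z ≟ v) (z′ ≟ v)
    where
    e′ : punchIn v (squash z) ≡ punchIn v (squash z′)
    e′ = cong (punchIn v) e
    cases : Dec (z ≡ v) → Dec (z′ ≡ v) → z ≡ z′ ⊎ (z ≡ u × z′ ≡ v) ⊎ (z ≡ v × z′ ≡ u)
    cases (yes p) (yes q) = inj₁ (trans p (sym q))
    cases (yes p) (no  q) = inj₂ (inj₂ (p , trans (sym (punchIn-squash-≢ q)) (trans (sym e′) (punchIn-squash-≡ p))))
    cases (no  p) (yes q) = inj₂ (inj₁ (trans (sym (punchIn-squash-≢ p)) (trans e′ (punchIn-squash-≡ q)) , q))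
    cases (no  p) (no  q) = inj₁ (trans (sym (punchIn-squash-≢ p)) (trans e′ (punchIn-squash-≢ q)))

data ContrPath (d : ℕ) : ∀ {m m′} → Trigraph (suc m) → Trigraph (suc m′) → Set where
  []   : ∀ {m} {c : Trigraph (suc m)} → ContrPath d c c
  step : ∀ {m m′} (c : Trigraph (suc (suc m))) {c′ : Trigraph (suc m′)} → MaxRedDegAtMost d c →
         (u v : Fin (suc (suc m))) → u ≢ v → ContrPath d (contract c u v) c′ → ContrPath d c c′

module _ {d : ℕ} where

  _++ᶜ_ : ∀ {m m′ m″} {c : Trigraph (suc m)} {c′ : Trigraph (suc m′)} {c″ : Trigraph (suc m″)} →
          ContrPath d c c′ → ContrPath d c′ c″ → ContrPath d c c″
  []                       ++ᶜ q = q
  step c bound u v u≢v p ++ᶜ q = step c bound u v u≢v (p ++ᶜ q)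

  _▷_ : ∀ {m m′} {c : Trigraph (suc m)} {c′ : Trigraph (suc m′)} →
        ContrPath d c c′ → ContrSeq d c′ → ContrSeq d c
  []                       ▷ seq = seq
  step c bound u v u≢v p ▷ seq = step c bound u v u≢v (p ▷ seq)

Fin1-irrelevant : (i j : Fin 1) → i ≡ j
Fin1-irrelevant zero zero = refl

module _ {n : ℕ} where
  open import Data.List.Membership.DecPropositional (_≟_ {n}) using (_∈?_)

  lookup-leafSet : (S : BTree n) (a : Fin n) → lookup (leafSet S) a ≡ does (a ∈? leaves S)
  lookup-leafSet S a = trans (lookup∘tabulate _ a) (go (leaves S))
    where
    go : ∀ ws → foldr (λ w b → does (a ≟ w) ∨ b) false ws ≡ does (a ∈? ws)
    go []       = refl
    go (w ∷ ws) = cong (does (a ≟ w) ∨_) (go ws)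

  ∈-leafSet : ∀ S {a : Fin n} → a ∈ leaves S → lookup (leafSet S) a ≡ true
  ∈-leafSet S {a} a∈S = trans (lookup-leafSet S a) (dec-true (a ∈? leaves S) a∈S)

  ∉-leafSet : ∀ S {a : Fin n} → a ∉ leaves S → lookup (leafSet S) a ≡ false
  ∉-leafSet S {a} a∉S = trans (lookup-leafSet S a) (dec-false (a ∈? leaves S) a∉S)

  ∈-leaf : ∀ {a v : Fin n} → a ∈ leaves (leaf v) → a ≡ v
  ∈-leaf (here a≡v) = a≡v

  decomp-unique : (T : BTree n) → IsDecompTree T → Unique (leaves T)
  decomp-unique T T↭V = Permutation.Unique-resp-↭ (setoid (Fin n)) (↭⇒↭ₛ (↭-sym T↭V)) (allFin⁺ n)

  decomp-covers : (T : BTree n) → IsDecompTree T → ∀ a → a ∈ leaves T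
  decomp-covers T T↭V a = ∈-resp-↭ (↭-sym T↭V) (∈-allFin a)

  reblock : BTree n → (Fin n → BTree n) → Fin n → BTree n
  reblock S β a with a ∈? leaves S
  ... | yes _ = S
  ... | no  _ = β a

  reblock-∈ : ∀ S β {a} → a ∈ leaves S → reblock S β a ≡ S
  reblock-∈ S β {a} a∈S with a ∈? leaves S
  ... | yes _   = refl
  ... | no  a∉S = contradiction a∈S a∉S

  reblock-∉ : ∀ S β {a} → a ∉ leaves S → reblock S β a ≡ β a
  reblock-∉ S β {a} a∉S with a ∈? leaves S
  ... | yes a∈S = contradiction a∈S a∉S
  ... | no  _   = refl

module Quotients {n : ℕ} (G : Graph n) where

  outerNbhd : BTree n → Fin n → Subset n
  outerNbhd S a = nbhd G (⁅ a ⁆ ∩ leafSet S) ∩ ∁ (leafSet S)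

  lookup-outerNbhd : ∀ S {a z} → a ∈ leaves S → z ∉ leaves S → lookup (outerNbhd S a) z ≡ adj G a z
  lookup-outerNbhd S {a} {z} a∈S z∉S = begin
    lookup (nbhd G A ∩ ∁ X) z            ≡⟨ lookup-zipWith _∧_ z (nbhd G A) (∁ X) ⟩
    lookup (nbhd G A) z ∧ lookup (∁ X) z ≡⟨ cong₂ _∧_ (lookup∘tabulate _ z) z∉X ⟩
    anyFin p ∧ true                       ≡⟨ ∧-identityʳ _ ⟩
    anyFin p                              ≡⟨ anyFin-single p only-a ⟩
    lookup A a ∧ adj G a z                ≡⟨ cong (_∧ adj G a z) a∈A ⟩
    adj G a z                             ∎
    where
    open ≡-Reasoning
    X A : Subset n
    X = leafSet S
    A = ⁅ a ⁆ ∩ X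
    z∉X : lookup (∁ X) z ≡ true
    z∉X = trans (lookup-map z not X) (cong not (∉-leafSet S z∉S))
    p : Fin n → Bool
    p u = lookup A u ∧ adj G u z
    only-a : ∀ {u} → T (p u) → u ≡ a
    only-a {u} t =
      x∈⁅y⁆⇒x≡y a (proj₁ (x∈p∩q⁻ ⁅ a ⁆ X (lookup⇒[]= u A (Equivalence.to T-≡ (proj₁ (Equivalence.to T-∧ t))))))
    a∈A : lookup A a ≡ true
    a∈A = []=⇒lookup (x∈p∩q⁺ (x∈⁅x⁆ a , lookup⇒[]= a X (∈-leafSet S a∈S)))

  OutsideTwins : BTree n → Fin n → Fin n → Set
  OutsideTwins S a b = ∀ {z} → z ∉ leaves S → adj G a z ≡ adj G b z

  outerNbhd-twins : ∀ S {a b} → a ∈ leaves S → b ∈ leaves S → outerNbhd S a ≡ outerNbhd S b → OutsideTwins S a b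
  outerNbhd-twins S a∈S b∈S e {z} z∉S =
    trans (sym (lookup-outerNbhd S a∈S z∉S)) (trans (cong (λ X → lookup X z) e) (lookup-outerNbhd S b∈S z∉S))

  OutsideTwins-⊆ : ∀ {S S′ a b} → leaves S ⊆ leaves S′ → OutsideTwins S a b → OutsideTwins S′ a b
  OutsideTwins-⊆ S⊆S′ twins z∉S′ = twins (z∉S′ ∘ S⊆S′)

  cut : BTree n → ℕ
  cut S = cutCount G (leafSet S)

  outerNbhd-listed : ∀ S a → outerNbhd S a ∈ distinctNbhds G (leafSet S)
  outerNbhd-listed S a = ∈-deduplicate⁺ (≡-dec _≟ᵇ_) (∈-map⁺ _ (∈-allSubsets ⁅ a ⁆))

  classIndex : (S : BTree n) → Fin n → Fin (cut S)
  classIndex S a = index (outerNbhd-listed S a)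

  classIndex-injective : ∀ S {a b} → classIndex S a ≡ classIndex S b → outerNbhd S a ≡ outerNbhd S b
  classIndex-injective S {a} {b} e =
    trans (lookup-index (outerNbhd-listed S a))
          (trans (cong (List.lookup (distinctNbhds G (leafSet S))) e) (sym (lookup-index (outerNbhd-listed S b))))

  Homogeneous : ∀ {k} → (Fin n → Fin k) → Fin k → Fin k → Bool → Set
  Homogeneous f x y t = ∀ {a b} → f a ≡ x → f b ≡ y → adj G a b ≡ t

  record Faithful {k} (c : Trigraph k) (f : Fin n → Fin k) : Set where
    field
      loopless    : ∀ x → c x x ≡ none
      homogeneous : ∀ {x y t} → x ≢ y → Homogeneous f x y t → c x y ≡ colour t

  module _ {k} {c : Trigraph k} {f : Fin n → Fin k} (faithful : Faithful c f) where
    open Faithful faithful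

    red-irreflexive : ∀ {x y} → T (isRed (c x y)) → x ≢ y
    red-irreflexive {x} x-red-x refl = subst (T ∘ isRed) (loopless x) x-red-x

    homogeneous-not-red : ∀ {x y t} → Homogeneous f x y t → ¬ T (isRed (c x y))
    homogeneous-not-red {t = t} h x-red-y =
      colour-not-red t (subst (T ∘ isRed) (homogeneous (red-irreflexive x-red-y) h) x-red-y)

  contract-faithful : ∀ {m} {c : Trigraph (suc m)} {f u v} (u≢v : u ≢ v) →
                      Faithful c f → Faithful (contract c u v) (squash u≢v ∘ f)
  contract-faithful {c = c} {f} {u} {v} u≢v faithful = record { loopless = loopless′ ; homogeneous = homogeneous′ }
    where
    open Faithful faithful
    pull : ∀ {x y z w t} → Homogeneous (squash u≢v ∘ f) x y t →
           squash u≢v z ≡ x → squash u≢v w ≡ y → Homogeneous f z w t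
    pull h z↦x w↦y fa fb = h (trans (cong (squash u≢v) fa) z↦x) (trans (cong (squash u≢v) fb) w↦y)

    loopless′ : ∀ x → contract c u v x x ≡ none
    loopless′ x with punchIn v x ≟ u
    ... | yes _ = refl
    ... | no  _ = loopless (punchIn v x)

    homogeneous′ : ∀ {x y t} → x ≢ y → Homogeneous (squash u≢v ∘ f) x y t → contract c u v x y ≡ colour t
    homogeneous′ {x} {y} x≢y h with punchIn v x ≟ u | punchIn v y ≟ u
    ... | yes p | yes q = contradiction (punchIn-injective v x y (trans p (sym q))) x≢y
    ... | yes p | no  q = mergeColour-colour
      (homogeneous (q ∘ sym)              (pull h (squash-u u≢v p) (squash-punchIn u≢v y)))
      (homogeneous (punchInᵢ≢i v y ∘ sym) (pull h (squash-v u≢v p) (squash-punchIn u≢v y)))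
    ... | no  p | yes q = mergeColour-colour
      (homogeneous p              (pull h (squash-punchIn u≢v x) (squash-u u≢v q)))
      (homogeneous (punchInᵢ≢i v x) (pull h (squash-punchIn u≢v x) (squash-v u≢v q)))
    ... | no  p | no  q =
      homogeneous (x≢y ∘ punchIn-injective v x y) (pull h (squash-punchIn u≢v x) (squash-punchIn u≢v y))

  Coarsens : ∀ {k k′} → (Fin n → Fin k) → (Fin n → Fin k′) → Set
  Coarsens f g = ∀ {a b} → f a ≡ f b → g a ≡ g b

  Collapsed : ∀ {k} → (Fin n → Fin k) → BTree n → Set
  Collapsed f S = ∀ {a b} → a ∈ leaves S → b ∈ leaves S → outerNbhd S a ≡ outerNbhd S b → f a ≡ f b

  Collapsed-coarsen : ∀ {k k′} {f : Fin n → Fin k} {g : Fin n → Fin k′} →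
                      Coarsens f g → ∀ S → Collapsed f S → Collapsed g S
  Collapsed-coarsen f⊑g S collapsed a∈S b∈S e = f⊑g (collapsed a∈S b∈S e)

  Together : (Fin n → BTree n) → Fin n → Fin n → Set
  Together β a b = β a ≡ β b × OutsideTwins (β a) a b

  Together-sym : ∀ {β a b} → Together β a b → Together β b a
  Together-sym (e , twins) = sym e , λ z∉ → sym (twins (subst (λ S → _ ∉ leaves S) (sym e) z∉))

  Together-trans : ∀ {β a b c} → Together β a b → Together β b c → Together β a c
  Together-trans (e₁ , twins₁) (e₂ , twins₂) =
    trans e₁ e₂ , λ z∉ → trans (twins₁ z∉) (twins₂ (subst (λ S → _ ∉ leaves S) e₁ z∉))

module Construction {n : ℕ} (G : Graph n) (N : ℕ) where
  open Quotients G
  open import Data.List.Membership.DecPropositional (_≟_ {n}) using (_∈?_)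

  WellSplit : ∀ {k} → (Fin n → Fin k) → BTree n → Set
  WellSplit f (leaf _)   = ⊤
  WellSplit f (node l r) = cut l ≤ N × cut r ≤ N × Collapsed f l × Collapsed f r

  WellSplit-coarsen : ∀ {k k′} {f : Fin n → Fin k} {g : Fin n → Fin k′} →
                      Coarsens f g → ∀ S → WellSplit f S → WellSplit g S
  WellSplit-coarsen f⊑g (leaf _)   _ = tt
  WellSplit-coarsen f⊑g (node l r) (l≤N , r≤N , l-collapsed , r-collapsed) =
    l≤N , r≤N , Collapsed-coarsen f⊑g l l-collapsed , Collapsed-coarsen f⊑g r r-collapsed

  -- β a is the block of a: the largest subtree finished so far that contains a.
  record Blocks (β : Fin n → BTree n) {k} (f : Fin n → Fin k) : Set where
    field
      own-block  : ∀ a → a ∈ leaves (β a)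
      coherent   : ∀ {a b} → b ∈ leaves (β a) → β b ≡ β a
      together   : ∀ {a b} → f a ≡ f b → Together β a b
      well-split : ∀ a → WellSplit f (β a)

  -- A red neighbour y of x is sent to the outer-neighbourhood class of a member of y in S; by collapsedness
  -- of the children this is injective, and it misses the class of a.
  redDegree≤-block : ∀ {k} {c : Trigraph k} {f : Fin n → Fin k} {x a} (S : BTree n) →
                     WellSplit f S → a ∈ leaves S → f a ≡ x →
                     (∀ y → T (isRed (c x y)) → x ≢ y) →
                     (∀ y → T (isRed (c x y)) → ∃[ b ] b ∈ leaves S × f b ≡ y) →
                     redDegree c x ≤ 2 * N ∸ 1
  redDegree≤-block {c = c} {f} {x} (leaf v) _ a∈S fa≡x irreflexive witness =
    ≤-trans (count-never (isRed ∘ c x) no-red) z≤n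
    where
    no-red : ∀ y → ¬ T (isRed (c x y))
    no-red y x-red-y with b , b∈S , fb≡y ← witness y x-red-y =
      irreflexive y x-red-y (trans (sym fa≡x) (trans (cong f (trans (∈-leaf a∈S) (sym (∈-leaf b∈S)))) fb≡y))
  redDegree≤-block {c = c} {f} {x} (node l r) (l≤N , r≤N , l-collapsed , r-collapsed) a∈S fa≡x irreflexive witness =
    <-+-bound (count<-avoiding (isRed ∘ c x) (key a∈S) class class-avoids class-injective) l≤N r≤N
    where
    key : ∀ {b} → b ∈ leaves (node l r) → Fin (cut l + cut r)
    key {b} b∈S with ∈-++⁻ (leaves l) b∈S
    ... | inj₁ _ = classIndex l b ↑ˡ cut r
    ... | inj₂ _ = cut l ↑ʳ classIndex r b

    key-injective : ∀ {b b′} (p : b ∈ leaves (node l r)) (p′ : b′ ∈ leaves (node l r)) →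
                    key p ≡ key p′ → f b ≡ f b′
    key-injective p p′ e with ∈-++⁻ (leaves l) p | ∈-++⁻ (leaves l) p′
    ... | inj₁ b∈l | inj₁ b′∈l = l-collapsed b∈l b′∈l (classIndex-injective l (↑ˡ-injective (cut r) _ _ e))
    ... | inj₁ _   | inj₂ _    = ⊥-elim (↑ˡ≢↑ʳ e)
    ... | inj₂ _   | inj₁ _    = ⊥-elim (↑ˡ≢↑ʳ (sym e))
    ... | inj₂ b∈r | inj₂ b′∈r = r-collapsed b∈r b′∈r (classIndex-injective r (↑ʳ-injective (cut l) _ _ e))

    class : ∀ y → T (isRed (c x y)) → Fin (cut l + cut r)
    class y x-red-y with _ , b∈S , _ ← witness y x-red-y = key b∈S

    class-avoids : ∀ {y} x-red-y → class y x-red-y ≢ key a∈S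
    class-avoids {y} x-red-y e with _ , b∈S , fb≡y ← witness y x-red-y =
      irreflexive y x-red-y (trans (sym fa≡x) (trans (key-injective a∈S b∈S (sym e)) fb≡y))

    class-injective : Injection class
    class-injective {y} {y′} p p′ e with _ , b∈S , fb≡y ← witness y p | _ , b′∈S , fb′≡y′ ← witness y′ p′ =
      trans (sym fb≡y) (trans (key-injective b∈S b′∈S e) fb′≡y′)

  module _ {β : Fin n → BTree n} {k} {c : Trigraph k} {f : Fin n → Fin k}
           (faithful : Faithful c f) (blocks : Blocks β f) where
    open Blocks blocks

    -- If no member of y lay in the block of a, every adjacency between x and y would equal adj G a b₁
    -- (twins across the blocks), making x, y homogeneous.
    red-witness : ∀ {a x} → f a ≡ x → ∀ y → T (isRed (c x y)) → ∃[ b ] b ∈ leaves (β a) × f b ≡ y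
    red-witness {a} {x} fa≡x y x-red-y with any? (λ b → (b ∈? leaves (β a)) ×-dec (f b ≟ y))
    ... | yes found = found
    ... | no outside with any? (λ b → f b ≟ y)
    ...   | no  empty      = ⊥-elim (homogeneous-not-red faithful {t = true} (λ _ fb → ⊥-elim (empty (_ , fb))) x-red-y)
    ...   | yes (b₁ , fb₁) = ⊥-elim (homogeneous-not-red faithful same-adjacency x-red-y)
      where
      same-adjacency : Homogeneous f x y (adj G a b₁)
      same-adjacency {a₂} {b₂} fa₂ fb₂ = begin
        adj G a₂ b₂ ≡⟨ sym (proj₂ (together (trans fa≡x (sym fa₂))) b₂∉βa) ⟩
        adj G a b₂  ≡⟨ Graph.sym G a b₂ ⟩
        adj G b₂ a  ≡⟨ sym (proj₂ (together (trans fb₁ (sym fb₂))) a∉βb₁) ⟩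
        adj G b₁ a  ≡⟨ Graph.sym G b₁ a ⟩
        adj G a b₁  ∎
        where
        open ≡-Reasoning
        b₂∉βa : b₂ ∉ leaves (β a)
        b₂∉βa b₂∈ = outside (b₂ , b₂∈ , fb₂)
        a∉βb₁ : a ∉ leaves (β b₁)
        a∉βb₁ a∈ = outside (b₁ , subst (λ S → b₁ ∈ leaves S) (sym (coherent a∈)) (own-block b₁) , fb₁)

    maxRedDeg≤ : MaxRedDegAtMost (2 * N ∸ 1) c
    maxRedDeg≤ x with any? (λ a → f a ≟ x)
    ... | yes (a , fa≡x) =
      redDegree≤-block {c = c} (β a) (well-split a) (own-block a) fa≡x (λ _ → red-irreflexive faithful) (red-witness fa≡x)
    ... | no empty = ≤-trans (count-never (isRed ∘ c x) no-red) z≤n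
      where
      no-red : ∀ y → ¬ T (isRed (c x y))
      no-red y = homogeneous-not-red faithful {t = true} (λ fa → ⊥-elim (empty (_ , fa)))

  Mergeable : (Fin n → BTree n) → ∀ {k} → (Fin n → Fin k) → Fin k → Fin k → Set
  Mergeable β f u v = ∀ {a b} → f a ≡ u → f b ≡ v → Together β a b

  merge-blocks : ∀ {β m} {f : Fin n → Fin (suc m)} {u v} (u≢v : u ≢ v) →
                 Blocks β f → Mergeable β f u v → Blocks β (squash u≢v ∘ f)
  merge-blocks {β} {f = f} u≢v blocks mergeable = record
    { own-block  = own-block
    ; coherent   = coherent
    ; together   = together′
    ; well-split = λ a → WellSplit-coarsen (cong (squash u≢v)) (β a) (well-split a)
    }
    where
    open Blocks blocks
    together′ : ∀ {a b} → squash u≢v (f a) ≡ squash u≢v (f b) → Together β a b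
    together′ e with squash-cases u≢v e
    ... | inj₁ fa≡fb                 = together fa≡fb
    ... | inj₂ (inj₁ (fa≡u , fb≡v)) = mergeable fa≡u fb≡v
    ... | inj₂ (inj₂ (fa≡v , fb≡u)) = Together-sym (mergeable fb≡u fa≡v)

  module _ {β : Fin n → BTree n} {k} {f : Fin n → Fin k} (blocks : Blocks β f) {S : BTree n}
           (nested : ∀ {a} → a ∈ leaves S → leaves (β a) ⊆ leaves S) (split : WellSplit f S) where
    open Blocks blocks

    reblock-cong : ∀ {a b} → β a ≡ β b → reblock S β a ≡ reblock S β b
    reblock-cong {a} {b} e with a ∈? leaves S | b ∈? leaves S
    ... | yes _   | yes _   = refl
    ... | no  _   | no  _   = e
    ... | yes a∈S | no  b∉S = contradiction (nested a∈S (subst (λ R → b ∈ leaves R) (sym e) (own-block b))) b∉S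
    ... | no  a∉S | yes b∈S = contradiction (nested b∈S (subst (λ R → a ∈ leaves R) e (own-block a))) a∉S

    reblock-blocks : Blocks (reblock S β) f
    reblock-blocks = record
      { own-block  = own-block′
      ; coherent   = coherent′
      ; together   = λ fa≡fb → let e , twins = together fa≡fb in reblock-cong e , twins-reblock twins
      ; well-split = well-split′
      }
      where
      own-block′ : ∀ a → a ∈ leaves (reblock S β a)
      own-block′ a with a ∈? leaves S
      ... | yes a∈S = a∈S
      ... | no  _   = own-block a

      coherent′ : ∀ {a b} → b ∈ leaves (reblock S β a) → reblock S β b ≡ reblock S β a
      coherent′ {a} b∈ with a ∈? leaves S
      ... | yes _   = reblock-∈ S β b∈
      ... | no  a∉S = trans (reblock-cong (coherent b∈)) (reblock-∉ S β a∉S)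

      twins-reblock : ∀ {a b} → OutsideTwins (β a) a b → OutsideTwins (reblock S β a) a b
      twins-reblock {a} twins with a ∈? leaves S
      ... | yes a∈S = OutsideTwins-⊆ {β a} {S} (nested a∈S) twins
      ... | no  _   = twins

      well-split′ : ∀ a → WellSplit f (reblock S β a)
      well-split′ a with a ∈? leaves S
      ... | yes _ = split
      ... | no  _ = well-split a

  record State (β : Fin n → BTree n) (m : ℕ) : Set where
    field
      trigraph : Trigraph (suc m)
      parts    : Fin n → Fin (suc m)
      faithful : Faithful trigraph parts
      blocks   : Blocks β parts

    bounded : MaxRedDegAtMost (2 * N ∸ 1) trigraph
    bounded = maxRedDeg≤ faithful blocks

  open State

  merge : ∀ {β m} (s : State β (suc m)) {u v} (u≢v : u ≢ v) → Mergeable β (parts s) u v → State β m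
  merge s {u} {v} u≢v mergeable = record
    { trigraph = contract (trigraph s) u v
    ; parts    = squash u≢v ∘ parts s
    ; faithful = contract-faithful u≢v (faithful s)
    ; blocks   = merge-blocks u≢v (blocks s) mergeable
    }

  reblocked : ∀ {β m S} (s : State β m) → (∀ {a} → a ∈ leaves S → leaves (β a) ⊆ leaves S) →
              WellSplit (parts s) S → State (reblock S β) m
  reblocked s nested split = record
    { trigraph = trigraph s
    ; parts    = parts s
    ; faithful = faithful s
    ; blocks   = reblock-blocks (blocks s) nested split
    }

  record Processed (S : BTree n) {β m} (s : State β m) : Set where
    field
      {β′}      : Fin n → BTree n
      {m′}      : ℕ
      state     : State β′ m′
      path      : ContrPath (2 * N ∸ 1) (trigraph s) (trigraph state)
      coarsens  : Coarsens (parts s) (parts state)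
      collapsed : Collapsed (parts state) S
      inside    : ∀ {a} → a ∈ leaves S → β′ a ≡ S
      outside   : ∀ {a} → a ∉ leaves S → β′ a ≡ β a

  open Processed

  already-processed : ∀ {S β m} (s : State β m) → Collapsed (parts s) S →
                      (∀ {a} → a ∈ leaves S → β a ≡ S) → Processed S s
  already-processed s collapsed inside =
    record { state = s ; path = [] ; coarsens = λ e → e ; collapsed = collapsed ; inside = inside ; outside = λ _ → refl }

  merge-then : ∀ {S β m} (s : State β (suc m)) {u v} (u≢v : u ≢ v) (mergeable : Mergeable β (parts s) u v) →
               Processed S (merge s u≢v mergeable) → Processed S s
  merge-then s {u} {v} u≢v _ o = record
    { state     = state o
    ; path      = step (trigraph s) (bounded s) u v u≢v (path o)
    ; coarsens  = coarsens o ∘ cong (squash u≢v)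
    ; collapsed = collapsed o
    ; inside    = inside o
    ; outside   = outside o
    }

  Violation : ∀ {k} → (Fin n → Fin k) → BTree n → Fin n → Fin n → Set
  Violation f S a b = a ∈ leaves S × b ∈ leaves S × outerNbhd S a ≡ outerNbhd S b × f a ≢ f b

  collapsed-or-violated : ∀ {k} (f : Fin n → Fin k) S → Collapsed f S ⊎ ∃₂ (Violation f S)
  collapsed-or-violated f S with any? (λ a → any? (λ b →
    (a ∈? leaves S) ×-dec (b ∈? leaves S) ×-dec ≡-dec _≟ᵇ_ (outerNbhd S a) (outerNbhd S b) ×-dec ¬? (f a ≟ f b)))
  ... | yes (a , b , violation) = inj₂ (a , b , violation)
  ... | no  no-violation        = inj₁ λ {a} {b} a∈S b∈S e →
    decidable-stable (f a ≟ f b) λ fa≢fb → no-violation (a , b , a∈S , b∈S , e , fa≢fb)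

  violation-mergeable : ∀ {β k} {f : Fin n → Fin k} {S a₀ b₀} → Blocks β f → (∀ {a} → a ∈ leaves S → β a ≡ S) →
                        Violation f S a₀ b₀ → Mergeable β f (f a₀) (f b₀)
  violation-mergeable {β} {S = S} {a₀} {b₀} blocks inside (a₀∈S , b₀∈S , e , _) fa≡fa₀ fb≡fb₀ =
    Together-trans (together fa≡fa₀) (Together-trans a₀~b₀ (together (sym fb≡fb₀)))
    where
    open Blocks blocks
    a₀~b₀ : Together β a₀ b₀
    a₀~b₀ = trans (inside a₀∈S) (sym (inside b₀∈S)) ,
            subst (λ R → OutsideTwins R a₀ b₀) (sym (inside a₀∈S)) (outerNbhd-twins S a₀∈S b₀∈S e)

  close : ∀ {β S} → (∀ {a} → a ∈ leaves S → β a ≡ S) → ∀ {m} (s : State β m) → Processed S s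
  close {S = S} inside s with collapsed-or-violated (parts s) S
  ... | inj₁ collapsed = already-processed s collapsed inside
  close inside {zero}  s | inj₂ (a , b , (_ , _ , _ , fa≢fb)) = contradiction (Fin1-irrelevant _ _) fa≢fb
  close {β} inside {suc m} s | inj₂ (a , b , violation@(_ , _ , _ , fa≢fb)) =
    merge-then s fa≢fb mergeable (close inside (merge s fa≢fb mergeable))
    where
    mergeable : Mergeable β (parts s) (parts s a) (parts s b)
    mergeable = violation-mergeable (blocks s) inside violation

  process : (S : BTree n) → Unique (leaves S) → All (λ R → cut R ≤ N) (properSubtrees S) →
            ∀ {β m} (s : State β m) → (∀ {a} → a ∈ leaves S → β a ≡ leaf a) → Processed S s
  process (leaf v) _ _ s at-leaves =
    already-processed s (λ a∈S b∈S _ → cong (parts s) (trans (∈-leaf a∈S) (sym (∈-leaf b∈S))))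
                        (λ a∈S → trans (at-leaves a∈S) (cong leaf (∈-leaf a∈S)))
  process (node l r) unique (l≤N ∷ r≤N ∷ small) {β} s at-leaves
    with l-unique , r-unique , disjoint ← Unique-++⁻ (leaves l) unique
       | l-small , r-small ← ++⁻ (properSubtrees l) small = record
    { state     = state o₃
    ; path      = path o₁ ++ᶜ (path o₂ ++ᶜ path o₃)
    ; coarsens  = coarsens o₃ ∘ coarsens o₂ ∘ coarsens o₁
    ; collapsed = collapsed o₃
    ; inside    = inside o₃
    ; outside   = outside′
    }
    where
    S : BTree n
    S = node l r

    o₁ : Processed l s
    o₁ = process l l-unique l-small s (at-leaves ∘ ∈-++⁺ˡ)

    o₂ : Processed r (state o₁)
    o₂ = process r r-unique r-small (state o₁) λ a∈r →
      trans (outside o₁ (λ a∈l → disjoint (a∈l , a∈r))) (at-leaves (∈-++⁺ʳ (leaves l) a∈r))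

    β₂ : Fin n → BTree n
    β₂ = β′ o₂

    nested : ∀ {a} → a ∈ leaves S → leaves (β₂ a) ⊆ leaves S
    nested a∈S with ∈-++⁻ (leaves l) a∈S
    ... | inj₁ a∈l = subst (λ R → leaves R ⊆ leaves S) (sym l-block) ∈-++⁺ˡ
      where
      l-block : β₂ _ ≡ l
      l-block = trans (outside o₂ λ a∈r → disjoint (a∈l , a∈r)) (inside o₁ a∈l)
    ... | inj₂ a∈r = subst (λ R → leaves R ⊆ leaves S) (sym (inside o₂ a∈r)) (∈-++⁺ʳ (leaves l))

    split : WellSplit (parts (state o₂)) S
    split = l≤N , r≤N , Collapsed-coarsen (coarsens o₂) l (collapsed o₁) , collapsed o₂

    o₃ : Processed S (reblocked {S = S} (state o₂) nested split)
    o₃ = close (reblock-∈ S β₂) (reblocked {S = S} (state o₂) nested split)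

    outside′ : ∀ {a} → a ∉ leaves S → β′ o₃ a ≡ β a
    outside′ {a} a∉S = begin
      β′ o₃ a        ≡⟨ outside o₃ a∉S ⟩
      reblock S β₂ a ≡⟨ reblock-∉ S β₂ a∉S ⟩
      β₂ a           ≡⟨ outside o₂ (a∉S ∘ ∈-++⁺ʳ (leaves l)) ⟩
      β′ o₁ a        ≡⟨ outside o₁ (a∉S ∘ ∈-++⁺ˡ) ⟩
      β a            ∎
      where open ≡-Reasoning

  finish : ∀ {β T} → (∀ a → a ∈ leaves T) → (∀ a → β a ≡ T) →
           ∀ {m} (s : State β m) → ContrSeq (2 * N ∸ 1) (trigraph s)
  finish covers only-T {zero}  s = done _ (bounded s)
  finish {β} {T} covers only-T {suc m} s =
    step _ (bounded s) zero (suc zero) (λ ()) (finish covers only-T (merge s (λ ()) all-together))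
    where
    all-together : Mergeable β (parts s) zero (suc zero)
    all-together {a} {b} _ _ =
      trans (only-T a) (sym (only-T b)) ,
      λ {z} z∉ → contradiction (subst (λ R → z ∈ leaves R) (sym (only-T a)) (covers z)) z∉

open Quotients using (cut)
open Construction using (State; Processed; process; finish)

treeCount≤⇒cut≤ : ∀ {n} (G : Graph n) {N} T → treeCount G T ≤ N → All (λ S → cut G S ≤ N) (properSubtrees T)
treeCount≤⇒cut≤ G T bound =
  map⁻ (foldr-forcesᵇ (λ x y x⊔y≤N → m⊔n≤o⇒m≤o x y x⊔y≤N , m⊔n≤o⇒n≤o x y x⊔y≤N) 1 _ bound)

initial : ∀ {n} (G : Graph (suc n)) N → State G N leaf n
initial G N = record
  { trigraph = toTrigraph G
  ; parts    = λ a → a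
  ; faithful = record { loopless = λ x → cong colour (irrefl G x) ; homogeneous = λ _ h → cong colour (h refl refl) }
  ; blocks   = record
    { own-block  = λ a → here refl
    ; coherent   = λ { (here refl) → refl }
    ; together   = λ { refl → refl , λ _ → refl }
    ; well-split = λ _ → tt
    }
  }

treeCount≤⇒twinWidth≤ : ∀ {n} (G : Graph (suc n)) {N} T → IsDecompTree T → treeCount G T ≤ N →
                        TwinWidthAtMost G (2 * N ∸ 1)
treeCount≤⇒twinWidth≤ G {N} T decomp width =
  path processed ▷ finish G N covers (λ a → inside processed (covers a)) (state processed)
  where
  open Construction.Processed
  covers : ∀ a → a ∈ leaves T
  covers = decomp-covers T decomp
  processed : Processed G N T (initial G N)
  processed = process G N T (decomp-unique T decomp) (treeCount≤⇒cut≤ G T width) (initial G N) (λ _ → refl)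

theorem4p2 : (n : ℕ) (G : Graph (suc n)) (N : ℕ) →
    HasBoolWidthExp G N → TwinWidthAtMost G (2 * N ∸ 1)
theorem4p2 n G N ((T , decomp , width) , _) = treeCount≤⇒twinWidth≤ G T decomp (≤-reflexive width)
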